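{- If $N$ is a $\beta$-normal form, then there exist a context $\Gamma$ and a type $\sigma\in\mathcal{T}$ such that $\Gamma\vdash_{SM_r}N:\sigma$.
   Context: Terms (de Bruijn): $M,N::=\underline{n}\mid (M\,N)\mid\lambda.M$, $n\in\mathbb{N}^*$; application associates to the left. A $\beta$-normal form is a term with no subterm of the form $((\lambda.M)\,N)$. Types: $\mathcal{A}$ is a denumerable set of type variables; $\tau,\sigma\in\mathcal{T}::=\alpha\mid u\to\tau$ and $u\in\mathcal{U}::=\omega\mid u\wedge u\mid\tau$, with $\wedge$ commutative, associative and with neutral element $\omega$; $\to$ associates to the right. Contexts: $\Gamma::=nil\mid u.\Gamma$ with $u\in\mathcal{U}$; $\omega^{k}.\Gamma$ is $\Gamma$ prefixed by $k$ copies of $\omega$. Intersection of contexts: $nil\wedge\Gamma=\Gamma\wedge nil=\Gamma$, $(u_1.\Gamma)\wedge(u_2.\Delta)=(u_1\wedge u_2).(\Gamma\wedge\Delta)$. System $SM_r$ derives judgements $\Gamma\vdash M:\tau$ by: (var$_r$) $(\sigma_1\to\cdots\to\sigma_n\to\alpha).nil\vdash\underline{1}:\sigma_1\to\cdots\to\sigma_n\to\alpha$ ($n\ge0$, $\sigma_i\in\mathcal{T}$, $\alpha\in\mathcal{A}$); (varn) from $\Gamma\vdash\underline{n}:\tau$ infer $\omega.\Gamma\vdash\underline{n+1}:\tau$; ($\to_i$) from $u.\Gamma\vdash M:\tau$ infer $\Gamma\vdash\lambda.M:u\to\tau$; ($\to_i'$) from $nil\vdash M:\tau$ infer $nil\vdash\lambda.M:\omega\to\tau$;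 ($\to_e'$) from $\Gamma\vdash M_1:\omega\to\tau$ and $\Delta\vdash M_2:\sigma$ infer $\Gamma\wedge\Delta\vdash(M_1\,M_2):\tau$; ($\to_e$) from $\Gamma\vdash M_1:(\sigma_1\wedge\cdots\wedge\sigma_n)\to\tau$ ($n\ge1$, $\sigma_i\in\mathcal{T}$) and $\Delta^i\vdash M_2:\sigma_i$ for all $i$ infer $\Gamma\wedge\Delta^1\wedge\cdots\wedge\Delta^n\vdash(M_1\,M_2):\tau$. -}

module Defs where

open import Data.Nat using (ℕ; zero; suc)
open import Data.List using (List; []; _∷_; foldr)
open import Data.Product using (Σ; _×_)
open import Relation.Nullary using (¬_)

-- Terms (de Bruijn).  Index convention: `var k` denotes the de Bruijn
-- index  k+1  (so `var 0` is \underline{1}); indices range over ℕ*.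

data Term : Set where
  var : ℕ → Term
  app : Term → Term → Term
  lam : Term → Term

data _⊑_ : Term → Term → Set where
  ⊑-refl : ∀ {M} → M ⊑ M
  ⊑-appˡ : ∀ {P M N} → P ⊑ M → P ⊑ app M N
  ⊑-appʳ : ∀ {P M N} → P ⊑ N → P ⊑ app M N
  ⊑-lam  : ∀ {P M} → P ⊑ M → P ⊑ lam M

βNF : Term → Set
βNF M = ∀ P Q → ¬ (app (lam P) Q ⊑ M)

-- An element of 𝒰 is a finite multiset of
-- types, represented as a list: ω = [], τ = τ ∷ [], u ∧ v = u ++ v.
-- Commutativity/associativity/neutrality of ∧ is accounted for by the
-- equivalence _≈T_ / _≈U_ below (lists up to permutation, recursively).

data Ty : Set where
  atom : ℕ → Ty
  _⇒_  : List Ty → Ty → Ty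

infixr 5 _⇒_

U : Set
U = List Ty

ω : U
ω = []

data Select {A : Set} : List A → A → List A → Set where
  here  : ∀ {x xs} → Select (x ∷ xs) x xs
  there : ∀ {x y xs rest} → Select xs y rest → Select (x ∷ xs) y (x ∷ rest)

mutual
  data _≈T_ : Ty → Ty → Set where
    atom≈ : ∀ {a} → atom a ≈T atom a
    ⇒≈    : ∀ {u u′ τ τ′} → u ≈U u′ → τ ≈T τ′ → (u ⇒ τ) ≈T (u′ ⇒ τ′)

  data _≈U_ : U → U → Set where
    []≈ : [] ≈U []
    ∷≈  : ∀ {x xs ys y rest} → Select ys y rest → x ≈T y → xs ≈U rest →
          (x ∷ xs) ≈U ys

arrows : List Ty → ℕ → Ty
arrows σs α = foldr (λ σ τ → (σ ∷ []) ⇒ τ) (atom α) σs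

Ctx : Set
Ctx = List U

nil : Ctx
nil = []

_∧C_ : Ctx → Ctx → Ctx
[] ∧C Δ = Δ
(u ∷ Γ) ∧C [] = u ∷ Γ
(u₁ ∷ Γ) ∧C (u₂ ∷ Δ) = (u₁ Data.List.++ u₂) ∷ (Γ ∧C Δ)

⋀C : Ctx → List Ctx → Ctx
⋀C Γ Δs = foldr (λ Δ acc → acc ∧C Δ) Γ (Data.List.reverse Δs)

infix 4 _⊢_∶_

mutual
  data _⊢_∶_ : Ctx → Term → Ty → Set where
    var-r : ∀ (σs : List Ty) (α : ℕ) →
            (arrows σs α ∷ []) ∷ nil ⊢ var 0 ∶ arrows σs α
    varn  : ∀ {Γ n τ} → Γ ⊢ var n ∶ τ → ω ∷ Γ ⊢ var (suc n) ∶ τ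
    →i    : ∀ {u Γ M τ} → u ∷ Γ ⊢ M ∶ τ → Γ ⊢ lam M ∶ (u ⇒ τ)
    →i′   : ∀ {M τ} → nil ⊢ M ∶ τ → nil ⊢ lam M ∶ (ω ⇒ τ)
    →e′   : ∀ {Γ Δ M₁ M₂ τ σ} → Γ ⊢ M₁ ∶ (ω ⇒ τ) → Δ ⊢ M₂ ∶ σ →
            Γ ∧C Δ ⊢ app M₁ M₂ ∶ τ
    →e    : ∀ {Γ M₁ M₂ τ σ σs Δs} → Γ ⊢ M₁ ∶ ((σ ∷ σs) ⇒ τ) →
            Args Δs M₂ (σ ∷ σs) →
            ⋀C Γ Δs ⊢ app M₁ M₂ ∶ τ

  data Args : List Ctx → Term → List Ty → Set where
    args[] : ∀ {M} → Args [] M []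
    args∷  : ∀ {Δ Δs M σ σ′ σs} → Δ ⊢ M ∶ σ′ → σ′ ≈T σ → Args Δs M σs →
             Args (Δ ∷ Δs) M (σ ∷ σs)

-- A β-normal form is λ…λ.(x N₁ ⋯ Nₖ) with every Nᵢ again normal. By
-- induction each Nᵢ has some type σᵢ; since var_r lets the head variable x
-- take any type σ₁ → ⋯ → σₖ → α, it can be applied to N₁, …, Nₖ by →e with
-- one derivation per argument, and the abstractions are then typed by →i
-- (or by →i′ when the body was typed in the empty context).
module Submission where

open import Defs
open import Data.Product using (Σ; ∃; _,_)
open import Data.Nat using (zero; suc)
open import Data.List using ([]; _∷_)

mutual
  ≈T-refl : ∀ τ → τ ≈T τ
  ≈T-refl (atom a) = atom≈
  ≈T-refl (u ⇒ τ)  = ⇒≈ (≈U-refl u) (≈T-refl τ)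

  ≈U-refl : ∀ u → u ≈U u
  ≈U-refl []       = []≈
  ≈U-refl (τ ∷ u)  = ∷≈ here (≈T-refl τ) (≈U-refl u)

βNF-lam : ∀ {M} → βNF (lam M) → βNF M
βNF-lam nf P Q s = nf P Q (⊑-lam s)

βNF-appˡ : ∀ {M N} → βNF (app M N) → βNF M
βNF-appˡ nf P Q s = nf P Q (⊑-appˡ s)

βNF-appʳ : ∀ {M N} → βNF (app M N) → βNF N
βNF-appʳ nf P Q s = nf P Q (⊑-appʳ s)

var-typable : ∀ n σs α → ∃ λ Γ → Γ ⊢ var n ∶ arrows σs α
var-typable zero    σs α = _ , var-r σs α
var-typable (suc n) σs α with var-typable n σs α
... | Γ , ⊢x = ω ∷ Γ , varn ⊢x

-- The target σs → α is left open because the head of an application must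
-- accept all arguments still to come.
mutual
  βNF-typable : (N : Term) → βNF N → Σ Ctx (λ Γ → Σ Ty (λ σ → Γ ⊢ N ∶ σ))
  βNF-typable (var n) _ with var-typable n [] 0
  ... | Γ , ⊢x = Γ , _ , ⊢x
  βNF-typable (lam M) nf with βNF-typable M (βNF-lam nf)
  ... | []      , _ , ⊢M = [] , _ , →i′ ⊢M
  ... | (u ∷ Γ) , _ , ⊢M = Γ , _ , →i ⊢M
  βNF-typable (app M N) nf with app-typable M N nf [] 0
  ... | Γ , ⊢MN = Γ , _ , ⊢MN

  app-typable : ∀ M N → βNF (app M N) → ∀ σs α →
                ∃ λ Γ → Γ ⊢ app M N ∶ arrows σs α
  app-typable M N nf σs α with βNF-typable N (βNF-appʳ nf)
  ... | _ , σ , ⊢N with head-typable M N nf (σ ∷ σs) α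
  ... | _ , ⊢M = _ , →e ⊢M (args∷ ⊢N (≈T-refl σ) args[])

  head-typable : ∀ M N → βNF (app M N) → ∀ σs α →
                 ∃ λ Γ → Γ ⊢ M ∶ arrows σs α
  head-typable (var n)     _ _  σs α = var-typable n σs α
  head-typable (lam P)     N nf σs α with () ← nf P N ⊑-refl
  head-typable (app M₁ M₂) _ nf σs α = app-typable M₁ M₂ (βNF-appˡ nf) σs α

corollary2p10 : (N : Term) → βNF N → Σ Ctx (λ Γ → Σ Ty (λ σ → Γ ⊢ N ∶ σ))
corollary2p10 = βNF-typable
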